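{- (Provably in $\mathsf{ACA}_0$.) Let $D$ be a $\subseteq$-preserving weakly finite dilator and let $f:n\to n'$ be a strictly increasing function between natural numbers. Then there is a unique strictly increasing function $g:B_D(n)\to B_D(n')$ such that (1) $g(m)=f(m)$ for every $m<n$; and (2) whenever $n\le m<B_D(n)$ and $m$ has $n$-normal form $B_{\alpha_k}\cdots B_{\alpha_1}(n)$, then $g(m)=B_{\alpha'_k}\cdots B_{\alpha'_1}(n')$, where $\alpha'_i=D(g)(\alpha_i)$ for each $i$.
   Context: $\mathsf{LO}$ is the category of linear orders with domain a subset of $\mathbb{N}$ and strictly increasing maps; a natural number $n$ is identified with the order $\{0,\dots,n-1\}$ and $\omega$ with $\mathbb{N}$. A dilator is a finitary, pullback-preserving functor $\mathsf{LO}\to\mathsf{LO}$ mapping wellorders to wellorders; it is weakly finite if $D(A)$ is finite for finite $A$, and $\subseteq$-preserving if for a suborder $B\subseteq A$, $D(B)$ is a suborder of $D(A)$ and inclusions are sent to inclusions. For $\beta\in D(\omega)$, $N\beta=\min\{n:\beta\in D(n)\}$. By transfinite recursion on $D(\omega)$, $B_\alpha(n)=\max(\{B_\beta(B_\beta(n)):\beta<_{D(\omega)}\alpha,\ N\beta\le n\}\cup\{n+1\})$ for $\alpha\in D(\omega)$, and $B_D(n)=\max(\{B_\beta(B_\beta(n)):\beta\in D(\omega),\ N\beta\le n\}\cup\{n+1\})$; $B_D(n)$ is viewed as the finite order $\{0,\dots,B_D(n)-1\}$. The $n$-normal form of a number $m$ with $n\le m<B_D(n)$ is the unique expression $B_{\alpha_k}\cdots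 B_{\alpha_1}(n)$ ($k\ge0$) with value $m$ such that $\alpha_k<_{D(\omega)}\dots<_{D(\omega)}\alpha_1$ and $N\alpha_{i+1}\le B_{\alpha_i}\cdots B_{\alpha_1}(n)$ for $0\le i<k$ (its existence and uniqueness is known); in particular each $\alpha_i$ lies in $D(B_D(n))$, so $D(g)(\alpha_i)$ is defined. -}

module Defs where

open import Data.Nat using (ℕ; zero; suc; _<_; _≤_; _<ᵇ_)
open import Data.Nat.Properties using (<ᵇ⇒<; <⇒<ᵇ; <-irrefl; <-trans; <-cmp)
open import Data.Bool using (Bool; true; T)
open import Data.Unit using (⊤; tt)
open import Data.Product using (Σ; _×_; _,_; proj₁; proj₂)
open import Data.Sum using (_⊎_; inj₁; inj₂)
open import Data.List using (List; []; _∷_)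
open import Data.List.Relation.Unary.All using (All; []; _∷_)
open import Data.List.Relation.Unary.Linked using (Linked)
open import Relation.Nullary using (¬_)
open import Relation.Binary.PropositionalEquality using (_≡_; refl)
open import Relation.Binary using (tri<; tri≈; tri>)
open import Induction.WellFounded using (WellFounded)

-- Linear orders whose domain is a subset of ℕ (sets coded as ℕ → Bool,
-- as in second-order arithmetic).

record LO : Set where
  field
    dom   : ℕ → Bool
    lt    : ℕ → ℕ → Bool
    irrefl : ∀ x → T (dom x) → ¬ T (lt x x)
    trans  : ∀ x y z → T (dom x) → T (dom y) → T (dom z) →
             T (lt x y) → T (lt y z) → T (lt x z)
    total  : ∀ x y → T (dom x) → T (dom y) →
             T (lt x y) ⊎ (x ≡ y ⊎ T (lt y x))
open LO public

Elem : LO → Set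
Elem A = Σ ℕ (λ x → T (dom A x))

_<[_]_ : ∀ {A : LO} → Elem A → LO → Elem A → Set
x <[ A ] y = T (lt A (proj₁ x) (proj₁ y))

record Hom (A B : LO) : Set where
  field
    fun  : Elem A → Elem B
    mono : ∀ (x y : Elem A) → T (lt A (proj₁ x) (proj₁ y)) →
           T (lt B (proj₁ (fun x)) (proj₁ (fun y)))
open Hom public

_≈H_ : ∀ {A B} → Hom A B → Hom A B → Set
f ≈H g = ∀ x → proj₁ (fun f x) ≡ proj₁ (fun g x)

idH : ∀ {A} → Hom A A
idH = record { fun = λ x → x ; mono = λ x y p → p }

_∘H_ : ∀ {A B C} → Hom B C → Hom A B → Hom A C
g ∘H f = record { fun = λ x → fun g (fun f x)
                ; mono = λ x y p → mono g (fun f x) (fun f y) (mono f x y p) }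

record _⊑_ (B A : LO) : Set where
  field
    incl-dom : ∀ x → T (dom B x) → T (dom A x)
    incl-lt  : ∀ x y → T (dom B x) → T (dom B y) → lt B x y ≡ lt A x y
open _⊑_ public

incl : ∀ {B A} → B ⊑ A → Hom B A
incl {B} {A} s = record
  { fun  = λ x → proj₁ x , incl-dom s (proj₁ x) (proj₂ x)
  ; mono = λ x y p → helper (incl-lt s (proj₁ x) (proj₁ y) (proj₂ x) (proj₂ y)) p }
  where
  helper : ∀ {b c : Bool} → b ≡ c → T b → T c
  helper refl p = p

Finite : LO → Set
Finite A = Σ ℕ λ b → ∀ x → T (dom A x) → x < b

WellOrder : LO → Set
WellOrder A = WellFounded (λ (x y : Elem A) → T (lt A (proj₁ x) (proj₁ y)))

IsPullback : ∀ {P A B C : LO} → Hom P A → Hom P B → Hom A C → Hom B C → Set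
IsPullback {P} {A} {B} {C} p₁ p₂ f g =
  ((f ∘H p₁) ≈H (g ∘H p₂)) ×
  (∀ (Q : LO) (q₁ : Hom Q A) (q₂ : Hom Q B) → (f ∘H q₁) ≈H (g ∘H q₂) →
     Σ (Hom Q P) λ u → ((p₁ ∘H u) ≈H q₁) × ((p₂ ∘H u) ≈H q₂) ×
       (∀ (u' : Hom Q P) → (p₁ ∘H u') ≈H q₁ → (p₂ ∘H u') ≈H q₂ → u' ≈H u))

natLO : ℕ → LO
natLO n = record
  { dom = λ x → x <ᵇ n
  ; lt  = _<ᵇ_
  ; irrefl = λ x _ p → <-irrefl refl (<ᵇ⇒< x x p)
  ; trans = λ x y z _ _ _ p q → <⇒<ᵇ (<-trans (<ᵇ⇒< x y p) (<ᵇ⇒< y z q))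
  ; total = tot }
  where
  tot : ∀ x y → T (x <ᵇ n) → T (y <ᵇ n) → T (x <ᵇ y) ⊎ (x ≡ y ⊎ T (y <ᵇ x))
  tot x y _ _ with <-cmp x y
  ... | tri< a _ _ = inj₁ (<⇒<ᵇ a)
  ... | tri≈ _ b _ = inj₂ (inj₁ b)
  ... | tri> _ _ c = inj₂ (inj₂ (<⇒<ᵇ c))

ωLO : LO
ωLO = record
  { dom = λ _ → true
  ; lt  = _<ᵇ_
  ; irrefl = λ x _ p → <-irrefl refl (<ᵇ⇒< x x p)
  ; trans = λ x y z _ _ _ p q → <⇒<ᵇ (<-trans (<ᵇ⇒< x y p) (<ᵇ⇒< y z q))
  ; total = tot }
  where
  tot : ∀ x y → ⊤ → ⊤ → T (x <ᵇ y) ⊎ (x ≡ y ⊎ T (y <ᵇ x))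
  tot x y _ _ with <-cmp x y
  ... | tri< a _ _ = inj₁ (<⇒<ᵇ a)
  ... | tri≈ _ b _ = inj₂ (inj₁ b)
  ... | tri> _ _ c = inj₂ (inj₂ (<⇒<ᵇ c))

record Dilator : Set₁ where
  field
    obj    : LO → LO
    map    : ∀ {A B} → Hom A B → Hom (obj A) (obj B)
    map-cong : ∀ {A B} {f g : Hom A B} → f ≈H g → map f ≈H map g
    map-id   : ∀ {A} → map (idH {A}) ≈H idH
    map-∘    : ∀ {A B C} (g : Hom B C) (f : Hom A B) →
               map (g ∘H f) ≈H (map g ∘H map f)
    finitary : ∀ (A : LO) (σ : Elem (obj A)) →
               Σ LO λ a → Σ (a ⊑ A) λ s → Finite a ×
                 Σ (Elem (obj a)) λ τ → proj₁ (fun (map (incl s)) τ) ≡ proj₁ σ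
    pullbacks : ∀ {P A B C : LO} (p₁ : Hom P A) (p₂ : Hom P B)
                (f : Hom A C) (g : Hom B C) →
                IsPullback p₁ p₂ f g →
                IsPullback (map p₁) (map p₂) (map f) (map g)
    wellorders : ∀ (A : LO) → WellOrder A → WellOrder (obj A)
open Dilator public

WeaklyFinite : Dilator → Set
WeaklyFinite D = ∀ (A : LO) → Finite A → Finite (obj D A)

SubsetPreserving : Dilator → Set
SubsetPreserving D = ∀ {B A : LO} (s : B ⊑ A) →
  Σ (obj D B ⊑ obj D A) λ _ →
    ∀ (σ : Elem (obj D B)) → proj₁ (fun (map D (incl s)) σ) ≡ proj₁ σ

module _ (D : Dilator) where

  InDω : ℕ → Set
  InDω β = T (dom (obj D ωLO) β)

  _≺_ : ℕ → ℕ → Set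
  β ≺ α = T (lt (obj D ωLO) β α)

  InD : ℕ → ℕ → Set
  InD k β = T (dom (obj D (natLO k)) β)

  IsN : ℕ → ℕ → Set
  IsN β k = InD k β × (∀ j → j < k → ¬ InD j β)

  NLe : ℕ → ℕ → Set
  NLe β n = Σ ℕ λ k → IsN β k × k ≤ n

  IsMax : (ℕ → Set) → ℕ → Set
  IsMax S m = S m × (∀ k → S k → k ≤ m)

  IsB : (ℕ → ℕ → ℕ) → Set
  IsB B = ∀ α → InDω α → ∀ n → IsMax
    (λ m → (Σ ℕ λ β → InDω β × β ≺ α × NLe β n × m ≡ B β (B β n)) ⊎ m ≡ suc n)
    (B α n)

  IsBD : (ℕ → ℕ → ℕ) → (ℕ → ℕ) → Set
  IsBD B BD = ∀ n → IsMax
    (λ m → (Σ ℕ λ β → InDω β × NLe β n × m ≡ B β (B β n)) ⊎ m ≡ suc n)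
    (BD n)

  module _ (B : ℕ → ℕ → ℕ) where

    -- the list α₁ ∷ α₂ ∷ … ∷ α_k represents B_{α_k} ⋯ B_{α_1};
    -- evalB x αs = B_{α_k}(⋯ B_{α_1}(x))
    evalB : ℕ → List ℕ → ℕ
    evalB x []       = x
    evalB x (α ∷ αs) = evalB (B α x) αs

    NCond : ℕ → List ℕ → Set
    NCond x []       = ⊤
    NCond x (α ∷ αs) = NLe α x × NCond (B α x) αs

    IsNormalForm : ℕ → ℕ → List ℕ → Set
    IsNormalForm n m αs =
      All InDω αs ×
      Linked (λ a b → b ≺ a) αs ×
      NCond n αs ×
      evalB n αs ≡ m

mapWith : ∀ {P : ℕ → Set} (xs : List ℕ) → All P xs → ((x : ℕ) → P x → ℕ) → List ℕ
mapWith []       []       h = []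
mapWith (x ∷ xs) (p ∷ ps) h = h x p ∷ mapWith xs ps h

Conditions : (D : Dilator) (B : ℕ → ℕ → ℕ) (BD : ℕ → ℕ) (n n' : ℕ) →
             Hom (natLO n) (natLO n') →
             Hom (natLO (BD n)) (natLO (BD n')) → Set
Conditions D B BD n n' f g =
  (∀ m (p : T (m <ᵇ n)) (q : T (m <ᵇ BD n)) →
     proj₁ (fun g (m , q)) ≡ proj₁ (fun f (m , p))) ×
  (∀ m (q : T (m <ᵇ BD n)) → n ≤ m → ∀ (αs : List ℕ) →
     IsNormalForm D B n m αs →
     (ps : All (λ α → T (dom (obj D (natLO (BD n))) α)) αs) →
     proj₁ (fun g (m , q)) ≡
       evalB D B n' (mapWith αs ps (λ α p → proj₁ (fun (map D g) (α , p)))))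

{-# OPTIONS --safe #-}
-- g is built on the initial segments of B_D(n) by recursion: below n it is f, and from n on
-- its value is forced by (2): for m = B_{αₗ}⋯B_{α₁}(n) in normal form, g(m) is
-- B_{D(g)αₗ}⋯B_{D(g)α₁}(n'), where D(g)(αᵢ) only depends on g below N αᵢ < m because D
-- preserves inclusions. This extends g monotonically into B_D(n') because D(g) turns n-normal
-- forms into n'-normal forms, and normal forms are ordered lexicographically by their values,
-- an order that D(g) preserves. The same recursion shows uniqueness.
module Submission where

open import Defs
open import Data.Nat using (ℕ; zero; suc; _<_; _≤_; _<ᵇ_; z≤n; _⊓_; _<?_)
open import Data.Nat.Properties
open import Data.Nat.Induction using (<-wellFounded; <-rec)
open import Data.Bool using (T)
open import Data.Bool.Properties using (T-irrelevant; T?)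
open import Data.Product using (Σ; _×_; _,_; proj₁; proj₂)
open import Data.Sum using (_⊎_; inj₁; inj₂)
open import Data.List using (List; []; _∷_; _∷ʳ_)
import Data.List as List
open import Data.List.Properties using (map-++)
open import Data.List.Reverse using (Reverse; []; _∶_∶ʳ_; reverseView)
open import Data.List.Relation.Unary.All using (All; []; _∷_)
open import Data.List.Relation.Unary.Linked using (Linked; []; [-]; _∷_)
import Data.List.Relation.Unary.Linked as Linked
open import Data.List.Relation.Binary.Lex.Strict using (Lex-<; halt; this; next)
open import Relation.Nullary using (yes; no; contradiction)
open import Relation.Binary.PropositionalEquality
  using (_≡_; refl; sym; cong; cong₂; subst; subst₂; module ≡-Reasoning) renaming (trans to ≡-trans)
open import Induction.WellFounded using (WellFounded; Acc; acc)
import Relation.Binary.Construct.On as On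
import Induction.WellFounded as WF

private
  variable
    j k c y : ℕ

fun-cong : ∀ {A B} (h : Hom A B) {x x' : Elem A} → proj₁ x ≡ proj₁ x' →
           proj₁ (fun h x) ≡ proj₁ (fun h x')
fun-cong h {a , p} {.a , q} refl rewrite T-irrelevant p q = refl

natLO-⊑ : j ≤ k → natLO j ⊑ natLO k
natLO-⊑ {j} j≤k = record
  { incl-dom = λ x x<j → <⇒<ᵇ (<-≤-trans (<ᵇ⇒< x j x<j) j≤k)
  ; incl-lt  = λ _ _ _ _ → refl }

natLO-⊑-ωLO : natLO k ⊑ ωLO
natLO-⊑-ωLO = record { incl-dom = λ _ _ → _ ; incl-lt = λ _ _ _ _ → refl }

ωLO-wellOrder : WellOrder ωLO
ωLO-wellOrder = WF.Subrelation.wellFounded (λ {x} {y} → <ᵇ⇒< (proj₁ x) (proj₁ y))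
                  (On.wellFounded proj₁ <-wellFounded)

-- Strictly increasing maps k → c, wrapped so that k and c are inferable from the map.
record _⇒ₙ_ (k c : ℕ) : Set where
  constructor mk
  field hom : Hom (natLO k) (natLO c)
open _⇒ₙ_ public

apply : k ⇒ₙ c → (z : ℕ) → T (z <ᵇ k) → ℕ
apply h z q = proj₁ (fun (hom h) (z , q))

apply-cong : ∀ (h : k ⇒ₙ c) {z z'} {q q'} → z ≡ z' → apply h z q ≡ apply h z' q'
apply-cong h = fun-cong (hom h)

apply-mono : ∀ (h : k ⇒ₙ c) {z z'} q q' → z < z' → apply h z q < apply h z' q'
apply-mono h {z} {z'} q q' z<z' = <ᵇ⇒< _ _ (mono (hom h) (z , q) (z' , q') (<⇒<ᵇ z<z'))

apply-< : ∀ (h : k ⇒ₙ c) z q → apply h z q < c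
apply-< {c = c} h z q = <ᵇ⇒< _ c (proj₂ (fun (hom h) (z , q)))

AgreeBelow : ∀ {k₁ k₂} → ℕ → k₁ ⇒ₙ c → k₂ ⇒ₙ c → Set
AgreeBelow y h₁ h₂ = ∀ z q₁ q₂ → z < y → apply h₁ z q₁ ≡ apply h₂ z q₂

MapsBelow : ℕ → ℕ → k ⇒ₙ c → Set
MapsBelow y b h = ∀ z q → z < y → apply h z q < b

empty⇒ₙ : 0 ⇒ₙ c
empty⇒ₙ {c} = mk {0} {c} (record { fun = λ () ; mono = λ () })

extend : (h : k ⇒ₙ c) (v : ℕ) → v < c → MapsBelow k v h → suc k ⇒ₙ c
extend {k} {c} h v v<c h<v = mk (record { fun = ext ; mono = ext-mono })
  where
  ext : Elem (natLO (suc k)) → Elem (natLO c)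
  ext (z , _) with z <? k
  ... | yes z<k = fun (hom h) (z , <⇒<ᵇ z<k)
  ... | no _    = v , <⇒<ᵇ v<c
  ext-mono : ∀ x y → T (proj₁ x <ᵇ proj₁ y) → T (proj₁ (ext x) <ᵇ proj₁ (ext y))
  ext-mono (z , _) (z' , z'<1+k) z<z' with z <? k | z' <? k
  ... | yes _   | yes _   = mono (hom h) _ _ z<z'
  ... | yes z<k | no _    = <⇒<ᵇ (h<v z _ z<k)
  ... | no z≮k  | yes z'<k = contradiction (<-trans (<ᵇ⇒< z z' z<z') z'<k) z≮k
  ... | no z≮k  | no _    =
    contradiction (<-≤-trans (<ᵇ⇒< z z' z<z') (<⇒≤pred (<ᵇ⇒< z' (suc k) z'<1+k))) z≮k

module _ (h : k ⇒ₙ c) (v : ℕ) (v<c : v < c) (h<v : MapsBelow k v h) where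

  extend-agrees : AgreeBelow k (extend h v v<c h<v) h
  extend-agrees z _ _ z<k with z <? k
  ... | yes _   = apply-cong h refl
  ... | no z≮k  = contradiction z<k z≮k

  extend-top : ∀ q → apply (extend h v v<c h<v) k q ≡ v
  extend-top _ with k <? k
  ... | yes k<k = contradiction k<k (<-irrefl refl)
  ... | no _    = refl

module SubsetPreservingDilator (D : Dilator) (sp : SubsetPreserving D) where

  InD-mono : j ≤ k → ∀ {β} → InD D j β → InD D k β
  InD-mono j≤k {β} = incl-dom (proj₁ (sp (natLO-⊑ j≤k))) β

  InD⇒InDω : ∀ {β} → InD D k β → InDω D β
  InD⇒InDω {k} {β} = incl-dom (proj₁ (sp (natLO-⊑-ωLO {k}))) β

  lt-D≡lt-Dω : ∀ {α β} → InD D k α → InD D k β → lt (obj D (natLO k)) α β ≡ lt (obj D ωLO) α β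
  lt-D≡lt-Dω {k} {α} {β} = incl-lt (proj₁ (sp (natLO-⊑-ωLO {k}))) α β

  NLe⇒InD : ∀ {β x} → NLe D β x → InD D x β
  NLe⇒InD (k , (β∈Dk , _) , k≤x) = InD-mono k≤x β∈Dk

  NLe⇒InDω : ∀ {β x} → NLe D β x → InDω D β
  NLe⇒InDω {x = x} β≤x = InD⇒InDω {x} (NLe⇒InD β≤x)

  InD⇒NLe : ∀ {β} x → InD D x β → NLe D β x
  InD⇒NLe zero β∈D0 = zero , (β∈D0 , λ _ ()) , z≤n
  InD⇒NLe {β} (suc x) β∈Dx+1 with T? (dom (obj D (natLO x)) β)
  ... | yes β∈Dx = let (k , isN , k≤x) = InD⇒NLe x β∈Dx in k , isN , m≤n⇒m≤1+n k≤x
  ... | no β∉Dx  =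
    suc x , (β∈Dx+1 , λ j j<1+x β∈Dj → β∉Dx (InD-mono (<⇒≤pred j<1+x) β∈Dj)) , ≤-refl

  -- the action of D(h) on codes, with junk value 0 outside D(k)
  Dmap : k ⇒ₙ c → ℕ → ℕ
  Dmap {k} h α with T? (dom (obj D (natLO k)) α)
  ... | yes p = proj₁ (fun (map D (hom h)) (α , p))
  ... | no _  = 0

  image : k ⇒ₙ c → List ℕ → List ℕ
  image h = List.map (Dmap h)

  Dmap-≡ : ∀ (h : k ⇒ₙ c) {α} (p : InD D k α) → Dmap h α ≡ proj₁ (fun (map D (hom h)) (α , p))
  Dmap-≡ {k} h {α} p with T? (dom (obj D (natLO k)) α)
  ... | yes q = fun-cong (map D (hom h)) refl
  ... | no ¬p = contradiction p ¬p

  Dmap-InD : ∀ (h : k ⇒ₙ c) {α} → InD D k α → InD D c (Dmap h α)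
  Dmap-InD {c = c} h α∈Dk =
    subst (InD D c) (sym (Dmap-≡ h α∈Dk)) (proj₂ (fun (map D (hom h)) (_ , α∈Dk)))

  Dmap-≺ : ∀ (h : k ⇒ₙ c) {α β} → InD D k α → InD D k β →
           _≺_ D α β → _≺_ D (Dmap h α) (Dmap h β)
  Dmap-≺ {k} {c} h {α} {β} α∈Dk β∈Dk α≺β =
    subst T (lt-D≡lt-Dω {c} (Dmap-InD h α∈Dk) (Dmap-InD h β∈Dk))
      (subst₂ (λ u v → T (lt (obj D (natLO c)) u v)) (sym (Dmap-≡ h α∈Dk)) (sym (Dmap-≡ h β∈Dk))
        (mono (map D (hom h)) (α , α∈Dk) (β , β∈Dk)
          (subst T (sym (lt-D≡lt-Dω {k} α∈Dk β∈Dk)) α≺β)))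

  -- D(h)(α) only depends on h below the support of α, since D(ι) is an inclusion
  Dmap-local : ∀ {k₁ k₂} (h₁ : k₁ ⇒ₙ c) (h₂ : k₂ ⇒ₙ c) → y ≤ k₁ → y ≤ k₂ →
               AgreeBelow y h₁ h₂ →
               ∀ {α} → InD D y α → Dmap h₁ α ≡ Dmap h₂ α
  Dmap-local {y = y} h₁ h₂ y≤k₁ y≤k₂ agree {α} α∈Dy =
    begin
      Dmap h₁ α                                      ≡⟨ restrict h₁ y≤k₁ ⟩
      proj₁ (fun (map D (hom h₁ ∘H incl s₁)) (α , α∈Dy)) ≡⟨ map-cong D agree′ (α , α∈Dy) ⟩
      proj₁ (fun (map D (hom h₂ ∘H incl s₂)) (α , α∈Dy)) ≡⟨ restrict h₂ y≤k₂ ⟨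
      Dmap h₂ α                                      ∎
    where
    open ≡-Reasoning
    s₁ = natLO-⊑ y≤k₁
    s₂ = natLO-⊑ y≤k₂
    agree′ : (hom h₁ ∘H incl s₁) ≈H (hom h₂ ∘H incl s₂)
    agree′ (z , z<y) = agree z _ _ (<ᵇ⇒< z y z<y)
    restrict : ∀ {k} (h : k ⇒ₙ c) (y≤k : y ≤ k) →
               Dmap h α ≡ proj₁ (fun (map D (hom h ∘H incl (natLO-⊑ y≤k))) (α , α∈Dy))
    restrict h y≤k =
      begin
        Dmap h α
          ≡⟨ Dmap-≡ h (InD-mono y≤k α∈Dy) ⟩
        proj₁ (fun (map D (hom h)) (α , InD-mono y≤k α∈Dy))
          ≡⟨ fun-cong (map D (hom h)) (proj₂ (sp s) (α , α∈Dy)) ⟨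
        proj₁ (fun (map D (hom h)) (fun (map D (incl s)) (α , α∈Dy)))
          ≡⟨ map-∘ D (hom h) (incl s) (α , α∈Dy) ⟨
        proj₁ (fun (map D (hom h ∘H incl s)) (α , α∈Dy))
          ∎
      where s = natLO-⊑ y≤k

  image-local : ∀ {k₁ k₂} (h₁ : k₁ ⇒ₙ c) (h₂ : k₂ ⇒ₙ c) → y ≤ k₁ → y ≤ k₂ →
                AgreeBelow y h₁ h₂ →
                   ∀ {L} → All (InD D y) L → image h₁ L ≡ image h₂ L
  image-local h₁ h₂ y≤k₁ y≤k₂ agree []             = refl
  image-local h₁ h₂ y≤k₁ y≤k₂ agree (α∈Dy ∷ L∈Dy) =
    cong₂ _∷_ (Dmap-local h₁ h₂ y≤k₁ y≤k₂ agree α∈Dy)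
              (image-local h₁ h₂ y≤k₁ y≤k₂ agree L∈Dy)

  mapWith≡image : ∀ (h : k ⇒ₙ c) L (L∈Dk : All (InD D k) L) →
                 mapWith L L∈Dk (λ α p → proj₁ (fun (map D (hom h)) (α , p))) ≡ image h L
  mapWith≡image h []      []             = refl
  mapWith≡image h (α ∷ L) (α∈Dk ∷ L∈Dk) =
    cong₂ _∷_ (sym (Dmap-≡ h α∈Dk)) (mapWith≡image h L L∈Dk)

  -- D(h) agrees on D(y) with D of the corestriction of h|y to b ⊓ c
  Dmap-bounded : ∀ (h : k ⇒ₙ c) {b} → y ≤ k → MapsBelow y b h →
                 ∀ {α} → InD D y α → InD D b (Dmap h α)
  Dmap-bounded {k} {c} {y} h {b} y≤k h<b {α} α∈Dy =
    InD-mono (m⊓n≤m b c) (subst (InD D (b ⊓ c)) (sym Dmap-h≡Dmap-r) (proj₂ (fun (map D r) (α , α∈Dy))))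
    where
    open ≡-Reasoning
    r : Hom (natLO y) (natLO (b ⊓ c))
    r = record
      { fun  = λ (z , z<y) → let q = incl-dom (natLO-⊑ y≤k) z z<y in
                 apply h z q , <⇒<ᵇ (⊓-glb (h<b z q (<ᵇ⇒< z y z<y)) (apply-< h z q))
      ; mono = λ x x' → mono (hom h) _ _ }
    s = natLO-⊑ (m⊓n≤n b c)
    ιr : y ⇒ₙ c
    ιr = mk (incl s ∘H r)
    Dmap-h≡Dmap-r : Dmap h α ≡ proj₁ (fun (map D r) (α , α∈Dy))
    Dmap-h≡Dmap-r =
      begin
        Dmap h α
          ≡⟨ Dmap-local h ιr y≤k ≤-refl (λ _ _ _ _ → apply-cong h refl) α∈Dy ⟩
        Dmap ιr α
          ≡⟨ Dmap-≡ ιr α∈Dy ⟩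
        proj₁ (fun (map D (incl s ∘H r)) (α , α∈Dy))
          ≡⟨ map-∘ D (incl s) r (α , α∈Dy) ⟩
        proj₁ (fun (map D (incl s)) (fun (map D r) (α , α∈Dy)))
          ≡⟨ proj₂ (sp s) (fun (map D r) (α , α∈Dy)) ⟩
        proj₁ (fun (map D r) (α , α∈Dy))
          ∎

evalB-∷ʳ : ∀ D B x xs α → evalB D B x (xs ∷ʳ α) ≡ B α (evalB D B x xs)
evalB-∷ʳ D B x []       α = refl
evalB-∷ʳ D B x (β ∷ xs) α = evalB-∷ʳ D B (B β x) xs α

NCond-∷ʳ : ∀ D B x xs α → NCond D B x xs → NLe D α (evalB D B x xs) → NCond D B x (xs ∷ʳ α)
NCond-∷ʳ D B x []       α _          α≤x = α≤x , _
NCond-∷ʳ D B x (β ∷ xs) α (β≤x , nc) α≤y = β≤x , NCond-∷ʳ D B (B β x) xs α nc α≤y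

module NormalForms (D : Dilator) (sp : SubsetPreserving D) (B : ℕ → ℕ → ℕ) (isB : IsB D B)
                   (BD : ℕ → ℕ) (isBD : IsBD D B BD) where
  open SubsetPreservingDilator D sp

  _≻_ : ℕ → ℕ → Set
  α ≻ β = _≺_ D β α

  Decreasing : List ℕ → Set
  Decreasing = Linked _≻_

  eval : ℕ → List ℕ → ℕ
  eval = evalB D B

  -- IsNormalForm without its value; the entries lie in D(ω) by NCond
  IsNormal : ℕ → List ℕ → Set
  IsNormal x L = Decreasing L × NCond D B x L

  NormalFormOf : ℕ → ℕ → List ℕ → Set
  NormalFormOf x m L = IsNormal x L × eval x L ≡ m

  _<ₗ_ : List ℕ → List ℕ → Set
  _<ₗ_ = Lex-< _≡_ (_≺_ D)

  B-inflationary : ∀ {α} → InDω D α → ∀ x → x < B α x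
  B-inflationary {α} α∈Dω x = proj₂ (isB α α∈Dω x) (suc x) (inj₂ refl)

  B-step : ∀ {α β x} → InDω D α → α ≻ β → NLe D β x → B β (B β x) ≤ B α x
  B-step {α} {β} {x} α∈Dω α≻β β≤x =
    proj₂ (isB α α∈Dω x) _ (inj₁ (β , NLe⇒InDω β≤x , α≻β , β≤x , refl))

  BD-inflationary : ∀ x → x < BD x
  BD-inflationary x = proj₂ (isBD x) (suc x) (inj₂ refl)

  BD-step : ∀ {β x} → NLe D β x → B β (B β x) ≤ BD x
  BD-step {β} {x} β≤x = proj₂ (isBD x) _ (inj₁ (β , NLe⇒InDω β≤x , β≤x , refl))

  NCond-InDω : ∀ {x} L → NCond D B x L → All (InDω D) L
  NCond-InDω []      _          = []
  NCond-InDω (α ∷ L) (α≤x , nc) = NLe⇒InDω α≤x ∷ NCond-InDω L nc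

  eval-inflationary : ∀ {x} L → NCond D B x L → x ≤ eval x L
  eval-inflationary []      _          = ≤-refl
  eval-inflationary (α ∷ L) (α≤x , nc) =
    ≤-trans (<⇒≤ (B-inflationary (NLe⇒InDω α≤x) _)) (eval-inflationary L nc)

  <-eval-∷ : ∀ {x α} L → NCond D B x (α ∷ L) → x < eval x (α ∷ L)
  <-eval-∷ L (α≤x , nc) = <-≤-trans (B-inflationary (NLe⇒InDω α≤x) _) (eval-inflationary L nc)

  NCond-InD : ∀ {x m} L → NCond D B x L → eval x L ≤ m → All (InD D m) L
  NCond-InD []      _              _    = []
  NCond-InD (α ∷ L) nc@(α≤x , nc′) ev≤m =
    InD-mono (≤-trans (eval-inflationary (α ∷ L) nc) ev≤m) (NLe⇒InD α≤x) ∷ NCond-InD L nc′ ev≤m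

  eval-<-B : ∀ {γ x} L → InDω D γ → Decreasing (γ ∷ L) → NCond D B x L → eval x L < B γ x
  eval-<-B         []      γ∈Dω _           _          = B-inflationary γ∈Dω _
  eval-<-B {x = x} (α ∷ L) γ∈Dω (γ≻α ∷ dec) (α≤x , nc) =
    <-≤-trans (eval-<-B L (NLe⇒InDω α≤x) dec nc) (B-step γ∈Dω γ≻α α≤x)

  eval-<-BD : ∀ {x} L → IsNormal x L → eval x L < BD x
  eval-<-BD []      _                  = BD-inflationary _
  eval-<-BD (α ∷ L) (dec , α≤x , nc) =
    <-≤-trans (eval-<-B L (NLe⇒InDω α≤x) dec nc) (BD-step α≤x)

  <ₗ⇒eval-< : ∀ {x} L M → IsNormal x L → IsNormal x M → L <ₗ M → eval x L < eval x M
  <ₗ⇒eval-< [] (β ∷ M) _ (_ , ncM) halt = <-eval-∷ M ncM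
  <ₗ⇒eval-< {x} (α ∷ L) (β ∷ M) (decL , α≤x , ncL) (_ , β≤x , ncM) (this α≺β) =
    begin-strict
      eval (B α x) L    <⟨ eval-<-B L (NLe⇒InDω α≤x) decL ncL ⟩
      B α (B α x)       ≤⟨ B-step (NLe⇒InDω β≤x) α≺β α≤x ⟩
      B β x             ≤⟨ eval-inflationary M ncM ⟩
      eval (B β x) M    ∎
    where open ≤-Reasoning
  <ₗ⇒eval-< (α ∷ L) (.α ∷ M) (decL , _ , ncL) (decM , _ , ncM) (next refl L<M) =
    <ₗ⇒eval-< L M (Linked.tail decL , ncL) (Linked.tail decM , ncM) L<M

  <ₗ-trichotomy : ∀ L M → All (InDω D) L → All (InDω D) M → L <ₗ M ⊎ L ≡ M ⊎ M <ₗ L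
  <ₗ-trichotomy []      []      _ _ = inj₂ (inj₁ refl)
  <ₗ-trichotomy []      (_ ∷ _) _ _ = inj₁ halt
  <ₗ-trichotomy (_ ∷ _) []      _ _ = inj₂ (inj₂ halt)
  <ₗ-trichotomy (α ∷ L) (β ∷ M) (α∈Dω ∷ L∈Dω) (β∈Dω ∷ M∈Dω)
    with total (obj D ωLO) α β α∈Dω β∈Dω
  ... | inj₁ α≺β        = inj₁ (this α≺β)
  ... | inj₂ (inj₂ β≺α) = inj₂ (inj₂ (this β≺α))
  ... | inj₂ (inj₁ refl) with <ₗ-trichotomy L M L∈Dω M∈Dω
  ...   | inj₁ L<M        = inj₁ (next refl L<M)
  ...   | inj₂ (inj₁ refl) = inj₂ (inj₁ refl)
  ...   | inj₂ (inj₂ M<L) = inj₂ (inj₂ (next refl M<L))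

  normal-injective : ∀ {x} L M → IsNormal x L → IsNormal x M → eval x L ≡ eval x M → L ≡ M
  normal-injective L M nfL nfM eq with <ₗ-trichotomy L M (NCond-InDω L (proj₂ nfL)) (NCond-InDω M (proj₂ nfM))
  ... | inj₁ L<M        = contradiction eq (<⇒≢ (<ₗ⇒eval-< L M nfL nfM L<M))
  ... | inj₂ (inj₁ L≡M) = L≡M
  ... | inj₂ (inj₂ M<L) = contradiction (sym eq) (<⇒≢ (<ₗ⇒eval-< M L nfM nfL M<L))

  eval-<⇒<ₗ : ∀ {x} L M → IsNormal x L → IsNormal x M → eval x L < eval x M → L <ₗ M
  eval-<⇒<ₗ L M nfL nfM ev< with <ₗ-trichotomy L M (NCond-InDω L (proj₂ nfL)) (NCond-InDω M (proj₂ nfM))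
  ... | inj₁ L<M         = L<M
  ... | inj₂ (inj₁ refl) = contradiction ev< (<-irrefl refl)
  ... | inj₂ (inj₂ M<L)  = contradiction ev< (<-asym (<ₗ⇒eval-< M L nfM nfL M<L))

  _≺ω_ : Elem (obj D ωLO) → Elem (obj D ωLO) → Set
  α ≺ω β = _≺_ D (proj₁ α) (proj₁ β)

  Dω-wellFounded : WellFounded _≺ω_
  Dω-wellFounded = wellorders D ωLO ωLO-wellOrder

  ≻-head-weaken : ∀ {α β} L → InDω D α → InDω D β → All (InDω D) L → α ≻ β →
                  Decreasing (β ∷ L) → Decreasing (α ∷ L)
  ≻-head-weaken []      _    _    _          _   _           = [-]
  ≻-head-weaken {α} {β} (γ ∷ L) α∈Dω β∈Dω (γ∈Dω ∷ _) α≻β (β≻γ ∷ dec) =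
    LO.trans (obj D ωLO) γ β α γ∈Dω β∈Dω α∈Dω β≻γ α≻β ∷ dec

  NormalFormBelow : ℕ → ℕ → ℕ → List ℕ → Set
  NormalFormBelow α x m L = Decreasing (α ∷ L) × NCond D B x L × eval x L ≡ m

  normalForm-<B : ∀ {α} (α∈Dω : InDω D α) → Acc _≺ω_ (α , α∈Dω) →
                  ∀ {x m} → x ≤ m → m < B α x →
                  Σ (List ℕ) (NormalFormBelow α x m)
  normalForm-<B {α} α∈Dω (acc rs) {x} {m} x≤m m<Bαx with proj₁ (isB α α∈Dω x)
  ... | inj₂ Bαx≡1+x = [] , [-] , _ , ≤-antisym x≤m (<⇒≤pred (subst (m <_) Bαx≡1+x m<Bαx))
  ... | inj₁ (β , β∈Dω , β≺α , β≤x , Bαx≡) with m <? B β x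
  ...   | yes m<Bβx =
          let (L , dec , nc , ev) = normalForm-<B β∈Dω (rs β≺α) x≤m m<Bβx
          in L , ≻-head-weaken L α∈Dω β∈Dω (NCond-InDω L nc) β≺α dec , nc , ev
  ...   | no m≮Bβx =
          let (L , dec , nc , ev) =
                normalForm-<B β∈Dω (rs β≺α) (≮⇒≥ m≮Bβx) (subst (m <_) Bαx≡ m<Bαx)
          in β ∷ L , β≺α ∷ dec , (β≤x , nc) , ev

  normalForm : ∀ {x m} → x ≤ m → m < BD x → Σ (List ℕ) (NormalFormOf x m)
  normalForm {x} {m} x≤m m<BDx with proj₁ (isBD x)
  ... | inj₂ BDx≡1+x = [] , ([] , _) , ≤-antisym x≤m (<⇒≤pred (subst (m <_) BDx≡1+x m<BDx))
  ... | inj₁ (β , β∈Dω , β≤x , BDx≡) with m <? B β x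
  ...   | yes m<Bβx =
          let (L , dec , nc , ev) = normalForm-<B β∈Dω (Dω-wellFounded _) x≤m m<Bβx
          in L , (Linked.tail dec , nc) , ev
  ...   | no m≮Bβx =
          let (L , dec , nc , ev) =
                normalForm-<B β∈Dω (Dω-wellFounded _) (≮⇒≥ m≮Bβx) (subst (m <_) BDx≡ m<BDx)
          in β ∷ L , (dec , β≤x , nc) , ev

  image-Decreasing : ∀ (h : k ⇒ₙ c) {L} → All (InD D k) L → Decreasing L → Decreasing (image h L)
  image-Decreasing h _                     []          = []
  image-Decreasing h _                     [-]         = [-]
  image-Decreasing h (α∈Dk ∷ L∈Dk@(β∈Dk ∷ _)) (α≻β ∷ dec) =
    Dmap-≺ h β∈Dk α∈Dk α≻β ∷ image-Decreasing h L∈Dk dec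

  image-<ₗ : ∀ (h : k ⇒ₙ c) {L M} → All (InD D k) L → All (InD D k) M → L <ₗ M →
            image h L <ₗ image h M
  image-<ₗ h _             _             halt          = halt
  image-<ₗ h (α∈Dk ∷ _)    (β∈Dk ∷ _)    (this α≺β)    = this (Dmap-≺ h α∈Dk β∈Dk α≺β)
  image-<ₗ h (_ ∷ L∈Dk)    (_ ∷ M∈Dk)    (next refl L<M) = next refl (image-<ₗ h L∈Dk M∈Dk L<M)

  IsNormal-∷ʳ⁻ : ∀ {x} pre α → IsNormal x (pre ∷ʳ α) → IsNormal x pre × NLe D α (eval x pre)
  IsNormal-∷ʳ⁻ []            α (_ , α≤x , _)            = ([] , _) , α≤x
  IsNormal-∷ʳ⁻ (β ∷ [])      α (_ , β≤x , α≤y , _)      = ([-] , β≤x , _) , α≤y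
  IsNormal-∷ʳ⁻ (β ∷ γ ∷ pre) α (β≻γ ∷ dec , β≤x , nc) =
    let ((dec′ , nc′) , α≤y) = IsNormal-∷ʳ⁻ (γ ∷ pre) α (dec , nc)
    in (β≻γ ∷ dec′ , β≤x , nc′) , α≤y

module Construction (D : Dilator) (sp : SubsetPreserving D) (B : ℕ → ℕ → ℕ) (isB : IsB D B)
                    (BD : ℕ → ℕ) (isBD : IsBD D B BD) (n n' : ℕ) (f : n ⇒ₙ n') where
  open SubsetPreservingDilator D sp
  open NormalForms D sp B isB BD isBD

  record IsApprox (h : k ⇒ₙ BD n') : Set where
    field
      extends-f  : ∀ z q p → apply h z q ≡ apply f z p
      transports : ∀ z q L → NormalFormOf n z L → apply h z q ≡ eval n' (image h L)
  open IsApprox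

  module _ (h : k ⇒ₙ BD n') (h-approx : IsApprox h) where

    image-MapsBelow-< : ∀ L → IsNormal n L → eval n L < k →
                        MapsBelow (eval n L) (eval n' (image h L)) h
    image-MapsBelow-< L nf L<k z q z<L =
      subst (apply h z q <_) (transports h-approx _ (<⇒<ᵇ L<k) L (nf , refl)) (apply-mono h q (<⇒<ᵇ L<k) z<L)

    -- N αᵢ₊₁ ≤ y := B_{αᵢ}⋯B_{α₁}(n) and h maps [0, y) below h(y), so N(D(h)αᵢ₊₁) ≤ h(y)
    image-NCond : ∀ {L} → Reverse L → IsNormal n L → eval n L ≤ k → NCond D B n' (image h L)
    image-NCond []              _  _    = _
    image-NCond (pre ∶ rs ∶ʳ α) nf L≤k =
      subst (NCond D B n') (sym (map-++ (Dmap h) pre (α ∷ [])))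
        (NCond-∷ʳ D B n' (image h pre) (Dmap h α) (image-NCond rs nf-pre (<⇒≤ pre<k)) Dα≤image-pre)
      where
      nf-pre : IsNormal n pre
      nf-pre = proj₁ (IsNormal-∷ʳ⁻ pre α nf)
      α≤pre : NLe D α (eval n pre)
      α≤pre = proj₂ (IsNormal-∷ʳ⁻ pre α nf)
      pre<k : eval n pre < k
      pre<k = <-≤-trans (subst (eval n pre <_) (sym (evalB-∷ʳ D B n pre α))
                                (B-inflationary (NLe⇒InDω α≤pre) _)) L≤k
      Dα≤image-pre : NLe D (Dmap h α) (eval n' (image h pre))
      Dα≤image-pre =
        InD⇒NLe _ (Dmap-bounded h (<⇒≤ pre<k) (image-MapsBelow-< pre nf-pre pre<k) (NLe⇒InD α≤pre))

    image-normal : ∀ L → IsNormal n L → eval n L ≤ k → IsNormal n' (image h L)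
    image-normal L nf@(dec , nc) L≤k =
      image-Decreasing h (NCond-InD L nc L≤k) dec , image-NCond (reverseView L) nf L≤k

    -- smaller numbers have lexicographically smaller normal forms, and D(h) preserves that order
    image-MapsBelow-≤ : ∀ L → IsNormal n L → eval n L ≤ k →
                        MapsBelow (eval n L) (eval n' (image h L)) h
    image-MapsBelow-≤ L nf L≤k z q z<L with z <? n
    ... | yes z<n =
          subst (_< eval n' (image h L)) (sym (extends-f h-approx z q (<⇒<ᵇ z<n)))
            (<-≤-trans (apply-< f z _) (eval-inflationary (image h L) (proj₂ (image-normal L nf L≤k))))
    ... | no z≮n with normalForm (≮⇒≥ z≮n) (<-trans z<L (eval-<-BD L nf))
    ...   | Lz , nfz , refl =
            begin-strict
              apply h (eval n Lz) q  ≡⟨ transports h-approx _ q Lz (nfz , refl) ⟩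
              eval n' (image h Lz)   <⟨ <ₗ⇒eval-< (image h Lz) (image h L)
                                             (image-normal Lz nfz Lz≤k) (image-normal L nf L≤k) Lz<L ⟩
              eval n' (image h L)    ∎
      where
      open ≤-Reasoning
      Lz≤k : eval n Lz ≤ k
      Lz≤k = <⇒≤ (<-≤-trans z<L L≤k)
      Lz<L : image h Lz <ₗ image h L
      Lz<L = image-<ₗ h (NCond-InD Lz (proj₂ nfz) Lz≤k) (NCond-InD L (proj₂ nf) L≤k)
                        (eval-<⇒<ₗ Lz L nfz nf z<L)

    extend-IsApprox : ∀ v (v<K' : v < BD n') (h<v : MapsBelow k v h) →
                      (∀ p → v ≡ apply f k p) →
                      (∀ L → NormalFormOf n k L → v ≡ eval n' (image h L)) →
                      IsApprox (extend h v v<K' h<v)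
    extend-IsApprox v v<K' h<v v≡f v≡image = record { extends-f = extends ; transports = transports⁺ }
      where
      open ≡-Reasoning
      h⁺ : suc k ⇒ₙ BD n'
      h⁺ = extend h v v<K' h<v
      agrees : AgreeBelow k h⁺ h
      agrees = extend-agrees h v v<K' h<v

      extends : ∀ z q p → apply h⁺ z q ≡ apply f z p
      extends z q p with m<1+n⇒m<n∨m≡n (<ᵇ⇒< z (suc k) q)
      ... | inj₁ z<k  = ≡-trans (agrees z q (<⇒<ᵇ z<k) z<k) (extends-f h-approx z _ p)
      ... | inj₂ refl = ≡-trans (extend-top h v v<K' h<v q) (v≡f p)

      image⁺≡image : ∀ {z} L → NormalFormOf n z L → z ≤ k → image h⁺ L ≡ image h L
      image⁺≡image L ((_ , nc) , refl) z≤k =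
        image-local h⁺ h (m≤n⇒m≤1+n z≤k) z≤k
          (λ z q₁ q₂ z<y → agrees z q₁ q₂ (<-≤-trans z<y z≤k)) (NCond-InD L nc ≤-refl)

      transports⁺ : ∀ z q L → NormalFormOf n z L → apply h⁺ z q ≡ eval n' (image h⁺ L)
      transports⁺ z q L nfz with m<1+n⇒m<n∨m≡n (<ᵇ⇒< z (suc k) q)
      ... | inj₁ z<k =
            begin
              apply h⁺ z q            ≡⟨ agrees z q (<⇒<ᵇ z<k) z<k ⟩
              apply h z (<⇒<ᵇ z<k)    ≡⟨ transports h-approx z _ L nfz ⟩
              eval n' (image h L)     ≡⟨ cong (eval n') (image⁺≡image L nfz (<⇒≤ z<k)) ⟨
              eval n' (image h⁺ L)    ∎
      ... | inj₂ refl =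
            begin
              apply h⁺ k q            ≡⟨ extend-top h v v<K' h<v q ⟩
              v                       ≡⟨ v≡image L nfz ⟩
              eval n' (image h L)     ≡⟨ cong (eval n') (image⁺≡image L nfz ≤-refl) ⟨
              eval n' (image h⁺ L)    ∎

    approx-step-<n : k < n → Σ (suc k ⇒ₙ BD n') IsApprox
    approx-step-<n k<n =
      extend h v v<K' h<v , extend-IsApprox v v<K' h<v (λ _ → apply-cong f refl) v≡image
      where
      v : ℕ
      v = apply f k (<⇒<ᵇ k<n)
      v<K' : v < BD n'
      v<K' = <-trans (apply-< f k _) (BD-inflationary n')
      h<v : MapsBelow k v h
      h<v z q z<k = subst (_< v) (sym (extends-f h-approx z q z<n)) (apply-mono f z<n _ z<k)
        where z<n = <⇒<ᵇ (<-trans z<k k<n)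
      v≡image : ∀ L → NormalFormOf n k L → v ≡ eval n' (image h L)
      v≡image L ((_ , nc) , refl) = contradiction (eval-inflationary L nc) (<⇒≱ k<n)

    approx-step-≥n : ∀ L → NormalFormOf n k L → Σ (suc k ⇒ₙ BD n') IsApprox
    approx-step-≥n L (nf , evL) =
      extend h v v<K' h<v , extend-IsApprox v v<K' h<v v≡f v≡image
      where
      v : ℕ
      v = eval n' (image h L)
      v<K' : v < BD n'
      v<K' = eval-<-BD (image h L) (image-normal L nf (≤-reflexive evL))
      h<v : MapsBelow k v h
      h<v = subst (λ y → MapsBelow y v h) evL (image-MapsBelow-≤ L nf (≤-reflexive evL))
      v≡f : ∀ p → v ≡ apply f k p
      v≡f p = contradiction (<ᵇ⇒< k n p) (≤⇒≯ (subst (n ≤_) evL (eval-inflationary L (proj₂ nf))))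
      v≡image : ∀ L′ → NormalFormOf n k L′ → v ≡ eval n' (image h L′)
      v≡image L′ (nf′ , evL′) =
        cong (λ M → eval n' (image h M)) (normal-injective L L′ nf nf′ (≡-trans evL (sym evL′)))

  approx : ∀ k → k ≤ BD n → Σ (k ⇒ₙ BD n') IsApprox
  approx zero    _      = empty⇒ₙ , record { extends-f = λ _ () ; transports = λ _ () }
  approx (suc k) k<BDn with approx k (<⇒≤ k<BDn) | k <? n
  ... | h , h-approx | yes k<n = approx-step-<n h h-approx k<n
  ... | h , h-approx | no k≮n  =
    let (L , nfk) = normalForm (≮⇒≥ k≮n) k<BDn in approx-step-≥n h h-approx L nfk

  approx-unique : ∀ (h₁ h₂ : k ⇒ₙ BD n') → k ≤ BD n → IsApprox h₁ → IsApprox h₂ →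
                  ∀ z q₁ q₂ → apply h₁ z q₁ ≡ apply h₂ z q₂
  approx-unique {k} h₁ h₂ k≤BDn h₁-approx h₂-approx = <-rec _ agree
    where
    agree : ∀ z → (∀ {z′} → z′ < z → ∀ q₁ q₂ → apply h₁ z′ q₁ ≡ apply h₂ z′ q₂) →
            ∀ q₁ q₂ → apply h₁ z q₁ ≡ apply h₂ z q₂
    agree z IH q₁ q₂ with z <? n
    ... | yes z<n =
          ≡-trans (extends-f h₁-approx z q₁ (<⇒<ᵇ z<n)) (sym (extends-f h₂-approx z q₂ (<⇒<ᵇ z<n)))
    ... | no z≮n with normalForm (≮⇒≥ z≮n) (<-≤-trans (<ᵇ⇒< z k q₁) k≤BDn)
    ...   | L , nfz@((_ , nc) , _) =
            begin
              apply h₁ z q₁            ≡⟨ transports h₁-approx z q₁ L nfz ⟩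
              eval n' (image h₁ L)     ≡⟨ cong (eval n') (image-local h₁ h₂ z≤k z≤k h₁≡h₂-below L∈Dz) ⟩
              eval n' (image h₂ L)     ≡⟨ transports h₂-approx z q₂ L nfz ⟨
              apply h₂ z q₂            ∎
      where
      open ≡-Reasoning
      z≤k : z ≤ k
      z≤k = <⇒≤ (<ᵇ⇒< z k q₁)
      L∈Dz : All (InD D z) L
      L∈Dz = NCond-InD L nc (≤-reflexive (proj₂ nfz))
      h₁≡h₂-below : AgreeBelow z h₁ h₂
      h₁≡h₂-below _ q₁ q₂ z′<z = IH z′<z q₁ q₂

  IsApprox⇒Conditions : (g : BD n ⇒ₙ BD n') → IsApprox g → Conditions D B BD n n' (hom f) (hom g)
  IsApprox⇒Conditions g g-approx = (λ m p q → extends-f g-approx m q p) , transported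
    where
    transported : ∀ m q → n ≤ m → ∀ L → IsNormalForm D B n m L → (L∈D : All (InD D (BD n)) L) →
                  apply g m q ≡ eval n' (mapWith L L∈D (λ α p → proj₁ (fun (map D (hom g)) (α , p))))
    transported m q _ L (_ , dec , nc , evL) L∈D =
      ≡-trans (transports g-approx m q L ((dec , nc) , evL)) (cong (eval n') (sym (mapWith≡image g L L∈D)))

  Conditions⇒IsApprox : (g : BD n ⇒ₙ BD n') → Conditions D B BD n n' (hom f) (hom g) → IsApprox g
  Conditions⇒IsApprox g (extends , transported) =
    record { extends-f = λ z q p → extends z p q ; transports = transports′ }
    where
    transports′ : ∀ z q L → NormalFormOf n z L → apply g z q ≡ eval n' (image g L)
    transports′ z q L ((dec , nc) , refl) =
      ≡-trans (transported z q (eval-inflationary L nc) L (NCond-InDω L nc , dec , nc , refl) L∈D)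
              (cong (eval n') (mapWith≡image g L L∈D))
      where
      L∈D : All (InD D (BD n)) L
      L∈D = NCond-InD L nc (<⇒≤ (<ᵇ⇒< z (BD n) q))

lemma3p4 : (D : Dilator) → SubsetPreserving D → WeaklyFinite D →
    (B : ℕ → ℕ → ℕ) → IsB D B → (BD : ℕ → ℕ) → IsBD D B BD →
    (n n' : ℕ) (f : Hom (natLO n) (natLO n')) →
    Σ (Hom (natLO (BD n)) (natLO (BD n'))) (λ g →
      Conditions D B BD n n' f g ×
      (∀ (g' : Hom (natLO (BD n)) (natLO (BD n'))) →
         Conditions D B BD n n' f g' → g' ≈H g))
lemma3p4 D sp _ B isB BD isBD n n' f =
  hom g , IsApprox⇒Conditions g g-approx ,
  λ g' g'-conditions (z , q) →
    approx-unique (mk g') g ≤-refl (Conditions⇒IsApprox (mk g') g'-conditions) g-approx z q q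
  where
  open Construction D sp B isB BD isBD n n' (mk f)
  g        = proj₁ (approx (BD n) ≤-refl)
  g-approx = proj₂ (approx (BD n) ≤-refl)
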